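{- Let $(L,\vee,\wedge,0,1)$ be a bounded lattice and $\Rightarrow$ a binary operation on $L$, and define $x^{a}:=x\Rightarrow a$ for all $a,x\in L$ with $x\ge a$. Then the following are equivalent: (i) $\Rightarrow$ satisfies (I0), (I1), (I2) and (I3); (ii) for each $a\in L$ the assignment $x\mapsto x^{a}$, $x\in[a,1]$, is an antitone extensive mapping of $[a,1]$ into itself with $1^{a}=a$, and $x\Rightarrow y=(x\vee y)^{y}$ for all $x,y\in L$.
   Context: The conditions on $\Rightarrow$ are, for all $x,y,z\in L$: (I0) $(x\vee y)\Rightarrow y=x\Rightarrow y$, $x\Rightarrow x=1$, $1\Rightarrow x=x$; (I1) $(x\Rightarrow y)\wedge y=y$; (I2) $x\le y$ implies $y\Rightarrow z\le x\Rightarrow z$; (I3) $[(x\Rightarrow y)\Rightarrow y]\wedge(x\vee y)=x\vee y$. Here $[a,1]=\{x\in L\mid a\le x\le 1\}$; a mapping $x\mapsto x^{a}$ of $[a,1]$ into itself is antitone if $x\le y$ implies $x^{a}\ge y^{a}$, and extensive if $(x^{a})^{a}\ge x$ for all $x\in[a,1]$. -}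

module Defs where

open import Level using (Level; _⊔_)
open import Data.Product using (_×_)
open import Relation.Binary.Core using (Rel)
open import Algebra.Core using (Op₂)
open import Relation.Binary.Lattice.Bundles using (BoundedLattice)

-- Conditions on a binary operation _⇒_ on a bounded lattice L.
-- (Carrier is a setoid; _⇒_ is assumed to respect ≈ in the statement.)
module _ {c ℓ₁ ℓ₂ : Level} (L : BoundedLattice c ℓ₁ ℓ₂) where
  open BoundedLattice L

  Congruent⇒ : Op₂ Carrier → Set (c ⊔ ℓ₁)
  Congruent⇒ _⇒_ = ∀ {x x′ y y′} → x ≈ x′ → y ≈ y′ → (x ⇒ y) ≈ (x′ ⇒ y′)

  I0 : Op₂ Carrier → Set (c ⊔ ℓ₁)
  I0 _⇒_ = (∀ x y → ((x ∨ y) ⇒ y) ≈ (x ⇒ y))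
         × (∀ x → (x ⇒ x) ≈ ⊤)
         × (∀ x → (⊤ ⇒ x) ≈ x)

  I1 : Op₂ Carrier → Set (c ⊔ ℓ₁)
  I1 _⇒_ = ∀ x y → ((x ⇒ y) ∧ y) ≈ y

  I2 : Op₂ Carrier → Set (c ⊔ ℓ₂)
  I2 _⇒_ = ∀ x y z → x ≤ y → (y ⇒ z) ≤ (x ⇒ z)

  I3 : Op₂ Carrier → Set (c ⊔ ℓ₁)
  I3 _⇒_ = ∀ x y → (((x ⇒ y) ⇒ y) ∧ (x ∨ y)) ≈ (x ∨ y)

  -- x^a := x ⇒ a, for x ∈ [a,1] (i.e. a ≤ x)
  sup : Op₂ Carrier → Carrier → Carrier → Carrier
  sup _⇒_ x a = x ⇒ a

  MapsInto : Op₂ Carrier → Carrier → Set (c ⊔ ℓ₂)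
  MapsInto _⇒_ a = ∀ x → a ≤ x → x ≤ ⊤ → (a ≤ sup _⇒_ x a) × (sup _⇒_ x a ≤ ⊤)

  AntitoneOn : Op₂ Carrier → Carrier → Set (c ⊔ ℓ₂)
  AntitoneOn _⇒_ a = ∀ x y → a ≤ x → x ≤ ⊤ → a ≤ y → y ≤ ⊤ → x ≤ y
                     → sup _⇒_ y a ≤ sup _⇒_ x a

  ExtensiveOn : Op₂ Carrier → Carrier → Set (c ⊔ ℓ₂)
  ExtensiveOn _⇒_ a = ∀ x → a ≤ x → x ≤ ⊤ → x ≤ sup _⇒_ (sup _⇒_ x a) a

  CondI : Op₂ Carrier → Set (c ⊔ ℓ₁ ⊔ ℓ₂)
  CondI _⇒_ = I0 _⇒_ × I1 _⇒_ × I2 _⇒_ × I3 _⇒_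

  CondII : Op₂ Carrier → Set (c ⊔ ℓ₁ ⊔ ℓ₂)
  CondII _⇒_ =
    (∀ a → MapsInto _⇒_ a × AntitoneOn _⇒_ a × ExtensiveOn _⇒_ a
           × (sup _⇒_ ⊤ a ≈ a))
    × (∀ x y → (x ⇒ y) ≈ sup _⇒_ (x ∨ y) y)

-- The two conditions are two presentations of the same data: (I0) says that
-- x ⇒ y is (x ∨ y)^y and fixes 1^a = a, while (I1), (I2), (I3) are exactly the
-- statements that x ↦ x^a maps [a,1] into itself, is antitone and is extensive
-- once one rewrites x ⇒ y as (x ∨ y)^y.  For the converse, x ⇒ x = 1 comes
-- from extensivity at 1: 1 ≤ (1^x)^x = x ⇒ x.
module Submission where

open import Defs
open import Level using (Level; _⊔_)
open import Algebra.Core using (Op₂)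
open import Function.Bundles using (_⇔_; mk⇔)
open import Relation.Binary.Lattice.Bundles using (BoundedLattice)
open import Data.Product using (_,_; proj₁)
import Relation.Binary.Lattice.Properties.JoinSemilattice as JoinProperties
import Relation.Binary.Lattice.Properties.MeetSemilattice as MeetProperties
import Relation.Binary.Reasoning.PartialOrder as ≤-Reasoning

module _ {c ℓ₁ ℓ₂ : Level} (L : BoundedLattice c ℓ₁ ℓ₂) where
  open BoundedLattice L
  open JoinProperties joinSemilattice using (∨-monotonic)
  open MeetProperties meetSemilattice using (y≤x⇒x∧y≈y)
  open ≤-Reasoning poset

  x∧y≈y⇒y≤x : ∀ {x y} → (x ∧ y) ≈ y → y ≤ x
  x∧y≈y⇒y≤x {x} {y} x∧y≈y = begin
    y     ≈⟨ Eq.sym x∧y≈y ⟩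
    x ∧ y ≤⟨ x∧y≤x x y ⟩
    x     ∎

  module _ (_⇒_ : Op₂ Carrier) where

    FactorsThroughJoin : Set (c ⊔ ℓ₁)
    FactorsThroughJoin = ∀ x y → (x ⇒ y) ≈ sup L _⇒_ (x ∨ y) y

    I0⇒factorsThroughJoin : I0 L _⇒_ → FactorsThroughJoin
    I0⇒factorsThroughJoin (join-elim , _ , _) x y = Eq.sym (join-elim x y)

    I1⇒mapsInto : I1 L _⇒_ → ∀ a → MapsInto L _⇒_ a
    I1⇒mapsInto i1 a x _ _ = x∧y≈y⇒y≤x (i1 x a) , maximum (x ⇒ a)

    I2⇒antitoneOn : I2 L _⇒_ → ∀ a → AntitoneOn L _⇒_ a
    I2⇒antitoneOn i2 a x y _ _ _ _ = i2 x y a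

    I3⇒extensiveOn : I3 L _⇒_ → ∀ a → ExtensiveOn L _⇒_ a
    I3⇒extensiveOn i3 a x _ _ = begin
      x                 ≤⟨ x≤x∨y x a ⟩
      x ∨ a             ≤⟨ x∧y≈y⇒y≤x (i3 x a) ⟩
      (x ⇒ a) ⇒ a       ∎

    mapsInto⇒I1 : FactorsThroughJoin → (∀ a → MapsInto L _⇒_ a) → I1 L _⇒_
    mapsInto⇒I1 factors mapsInto x y = y≤x⇒x∧y≈y (begin
      y                 ≤⟨ proj₁ (mapsInto y (x ∨ y) (y≤x∨y x y) (maximum _)) ⟩
      (x ∨ y) ⇒ y       ≈⟨ Eq.sym (factors x y) ⟩
      x ⇒ y             ∎)

    antitoneOn⇒I2 : FactorsThroughJoin → (∀ a → AntitoneOn L _⇒_ a) → I2 L _⇒_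
    antitoneOn⇒I2 factors antitone x y z x≤y = begin
      y ⇒ z             ≈⟨ factors y z ⟩
      (y ∨ z) ⇒ z       ≤⟨ antitone z (x ∨ z) (y ∨ z) (y≤x∨y x z) (maximum _)
                             (y≤x∨y y z) (maximum _) (∨-monotonic x≤y refl) ⟩
      (x ∨ z) ⇒ z       ≈⟨ Eq.sym (factors x z) ⟩
      x ⇒ z             ∎

    module _ (cong⇒ : Congruent⇒ L _⇒_) where

      extensiveOn⇒I3 : FactorsThroughJoin → (∀ a → ExtensiveOn L _⇒_ a) →
                       I3 L _⇒_
      extensiveOn⇒I3 factors extensive x y = y≤x⇒x∧y≈y (begin
        x ∨ y                 ≤⟨ extensive y (x ∨ y) (y≤x∨y x y) (maximum _) ⟩
        ((x ∨ y) ⇒ y) ⇒ y     ≈⟨ cong⇒ (Eq.sym (factors x y)) Eq.refl ⟩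
        (x ⇒ y) ⇒ y           ∎)

      extensiveOn⇒⇒-refl : (∀ a → ExtensiveOn L _⇒_ a) → (∀ a → (⊤ ⇒ a) ≈ a) →
                           ∀ a → (a ⇒ a) ≈ ⊤
      extensiveOn⇒⇒-refl extensive ⊤⇒a≈a a = antisym (maximum (a ⇒ a)) (begin
        ⊤                 ≤⟨ extensive a ⊤ (maximum a) refl ⟩
        (⊤ ⇒ a) ⇒ a       ≈⟨ cong⇒ (⊤⇒a≈a a) Eq.refl ⟩
        a ⇒ a             ∎)

proposition2 : {c ℓ₁ ℓ₂ : Level} (L : BoundedLattice c ℓ₁ ℓ₂)
               (_⇒_ : Op₂ (BoundedLattice.Carrier L)) →
               Congruent⇒ L _⇒_ →
               CondI L _⇒_ ⇔ CondII L _⇒_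
proposition2 L _⇒_ cong⇒ = mk⇔ condI⇒condII condII⇒condI
  where
  open BoundedLattice L using (Carrier; _≈_; ⊤; module Eq)

  condI⇒condII : CondI L _⇒_ → CondII L _⇒_
  condI⇒condII (i0@(_ , _ , ⊤⇒a≈a) , i1 , i2 , i3) =
      (λ a → I1⇒mapsInto L _⇒_ i1 a , I2⇒antitoneOn L _⇒_ i2 a
           , I3⇒extensiveOn L _⇒_ i3 a , ⊤⇒a≈a a)
    , I0⇒factorsThroughJoin L _⇒_ i0

  condII⇒condI : CondII L _⇒_ → CondI L _⇒_
  condII⇒condI (restrictions , factors) =
      ( (λ x y → Eq.sym (factors x y))
      , extensiveOn⇒⇒-refl L _⇒_ cong⇒ extensive ⊤⇒a≈a
      , ⊤⇒a≈a )
    , mapsInto⇒I1 L _⇒_ factors mapsInto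
    , antitoneOn⇒I2 L _⇒_ factors antitone
    , extensiveOn⇒I3 L _⇒_ cong⇒ factors extensive
    where
    mapsInto : ∀ a → MapsInto L _⇒_ a
    mapsInto a = let (m , _ , _ , _) = restrictions a in m
    antitone : ∀ a → AntitoneOn L _⇒_ a
    antitone a = let (_ , t , _ , _) = restrictions a in t
    extensive : ∀ a → ExtensiveOn L _⇒_ a
    extensive a = let (_ , _ , e , _) = restrictions a in e
    ⊤⇒a≈a : ∀ (a : Carrier) → (⊤ ⇒ a) ≈ a
    ⊤⇒a≈a a = let (_ , _ , _ , u) = restrictions a in u
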